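{- Let $N \geq 3$ be an integer and let $H_N$ be the $(N-1)\times(N-1)$ matrix, with rows and columns indexed by $1,\dots,N-1$, whose entries are \[ H_N(i,j)=\begin{cases} 2 & \text{if } i=j,\\ -1 & \text{if } j\equiv i-1 \pmod N \text{ or } j\equiv i-2 \pmod N,\\ 0 & \text{otherwise.}\end{cases} \] Then $H_N$ is invertible, and for $1\le i,j\le N-1$ the entries of $H_N^{ -1}$ are \[ H_N^{ -1}(i,j)=\begin{cases} \dfrac{J_iJ_{N-i-1}}{J_N} & \text{if } j=i+1,\\[2mm] \dfrac{J_{i-j+1}(J_{N-i+j-2}+J_{N-i+j-1})-(-1)^{i+j}J_{j-1}J_{N-i-1}}{J_N} & \text{if } j<i+1 \text{ and } (i,j)\neq(N-1,1),\\[2mm] \dfrac{J_iJ_{N-j}(J_{j-i-1}+J_{j-i})}{J_N} & \text{if } j>i+1,\\[2mm] \dfrac{J_{N-1}}{J_N} & \text{if } (i,j)=(N-1,1), \end{cases} \] where $J_n$ denotes the $n$-th Jacobsthal number.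
   Context: The Jacobsthal numbers are defined by $J_0=0$, $J_1=1$, and $J_{n+2}=J_{n+1}+2J_n$ for $n\ge 0$. The matrix $H_N$ is the coefficient matrix of the linear system $2h(l)-h(l-1)-h(l-2)=2$ ($1\le l\le N-1$, indices mod $N$, $h(0)=0$) satisfied by the average hitting times $h(l)$ from vertex $0$ to vertex $l$ of the simple random walk on the Cayley graph $\mathrm{Cay}(\mathbb{Z}_N,\{+1,+2\})$; equivalently it is the transpose of the Laplacian of that directed Cayley graph with the row and column of vertex $0$ removed. -}

module Defs where

open import Data.Bool using (Bool; true; false; if_then_else_; _∧_; _∨_)
open import Data.Nat as ℕ using (ℕ; zero; suc; _+_; _*_; _∸_; _≡ᵇ_; _<ᵇ_; _%_)
open import Data.Nat.Properties using (≤-trans; m≤m+n)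
open import Data.Fin using (Fin; toℕ)
open import Relation.Binary.PropositionalEquality using (_≡_)
open import Data.Product using (_×_)
open import Data.Integer as ℤ using (ℤ; +_)
open import Data.Rational as ℚ using (ℚ; _/_)

J : ℕ → ℕ
J zero = 0
J (suc zero) = 1
J (suc (suc n)) = J (suc n) + 2 * J n

J-pos : ∀ n → 1 ℕ.≤ J (suc n)
J-pos zero = ℕ.s≤s ℕ.z≤n
J-pos (suc n) = ≤-trans (J-pos n) (m≤m+n (J (suc n)) (2 * J n))

J-nonZero : ∀ n → ℕ.NonZero (J (suc n))
J-nonZero n = ℕ.>-nonZero (J-pos n)

-- z / J N as a rational (N ≥ 1 in all uses; the zero case is never used)
divJ : ℤ → ℕ → ℚ
divJ z zero = ℚ.0ℚ
divJ z (suc m) = _/_ z (J (suc m)) {{J-nonZero m}}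

modEq : ℕ → ℕ → ℕ → Bool
modEq zero a b = a ≡ᵇ b
modEq (suc m) a b = (a % suc m) ≡ᵇ (b % suc m)

-- (N-1)×(N-1) square matrices over ℚ; Fin (N ∸ 1) index k stands for k+1 ∈ {1,…,N-1}
Mat : ℕ → Set
Mat N = Fin (N ∸ 1) → Fin (N ∸ 1) → ℚ

idx : ∀ {N} → Fin (N ∸ 1) → ℕ
idx k = suc (toℕ k)

Hentry : ℕ → ℕ → ℕ → ℚ
Hentry N i j =
  if i ≡ᵇ j then ℚ.1ℚ ℚ.+ ℚ.1ℚ
  else if modEq N (j + 1) i ∨ modEq N (j + 2) i
       then ℚ.- ℚ.1ℚ
       else ℚ.0ℚ
-- note: for i ≥ 1, "j ≡ i-1 (mod N)" is j+1 ≡ i (mod N), and "j ≡ i-2 (mod N)" is j+2 ≡ i (mod N);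

H : (N : ℕ) → Mat N
H N i j = Hentry N (idx {N} i) (idx {N} j)

Jz : ℕ → ℤ
Jz n = + J n

sgn : ℕ → ℤ
sgn zero = ℤ.1ℤ
sgn (suc n) = ℤ.- sgn n

HinvEntry : ℕ → ℕ → ℕ → ℚ
HinvEntry N i j =
  if (i ≡ᵇ (N ∸ 1)) ∧ (j ≡ᵇ 1) then divJ (Jz (N ∸ 1)) N
  else if j ≡ᵇ i + 1 then divJ (Jz i ℤ.* Jz (N ∸ (i + 1))) N
  else if j <ᵇ i + 1 then
    divJ (Jz ((i + 1) ∸ j) ℤ.* (Jz ((N + j) ∸ (i + 2)) ℤ.+ Jz ((N + j) ∸ (i + 1)))
          ℤ.- sgn (i + j) ℤ.* Jz (j ∸ 1) ℤ.* Jz (N ∸ (i + 1))) N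
  else divJ (Jz i ℤ.* Jz (N ∸ j) ℤ.* (Jz (j ∸ (i + 1)) ℤ.+ Jz (j ∸ i))) N

Hinv : (N : ℕ) → Mat N
Hinv N i j = HinvEntry N (idx {N} i) (idx {N} j)

sumFin : (n : ℕ) → (Fin n → ℚ) → ℚ
sumFin zero f = ℚ.0ℚ
sumFin (suc n) f = f Fin.zero ℚ.+ sumFin n (λ k → f (Fin.suc k))

mul : (N : ℕ) → Mat N → Mat N → Mat N
mul N A B i j = sumFin (N ∸ 1) (λ k → A i k ℚ.* B k j)

I : (N : ℕ) → Mat N
I N i j = if toℕ i ≡ᵇ toℕ j then ℚ.1ℚ else ℚ.0ℚ

IsInverse : (N : ℕ) → Mat N → Mat N → Set
IsInverse N A B =
  (∀ i j → mul N A B i j ≡ I N i j) × (∀ i j → mul N B A i j ≡ I N i j)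

module Submission where

-- Let adj N := J N · Hinv N, an integer matrix. With indices read modulo N and the entry
-- at index 0 taken to be 0, row a of H N sends a vector x to 2 x(a) − x(a−1) − x(a−2), and
-- column b sends y to 2 y(b) − y(b+1) − y(b+2). So H · adj = adj · H = J N · I says that
-- every column and every row of adj satisfies this three-term recurrence, with defect J N
-- on the diagonal. Splitting by the position of the entry relative to the diagonal leaves
-- twelve polynomial identities between Jacobsthal numbers, consequences of
-- J (n+2) = J (n+1) + 2 J n and of J (m+n) = J m J (n+1) + J (m+1) J n − J m J n.

open import Data.Bool using (Bool; true; false; T; if_then_else_; _∧_; _∨_)
open import Data.Bool.Properties using (T-∧; T-∨; if-float; ∧-zeroʳ; ∧-identityʳ; ∨-identityʳ)
open import Data.Empty using (⊥; ⊥-elim)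
open import Data.Fin as Fin using (Fin; toℕ)
import Data.Fin.Properties as Fin
open import Data.Integer as ℤ using (ℤ; +_; _+_; _*_; _-_; -_)
import Data.Integer.Properties as ℤ
open import Data.Integer.Tactic.RingSolver using (solve-∀; solve)
open import Data.List using (_∷_; [])
open import Data.Nat as ℕ using (ℕ; zero; suc; _≤_; _<_; _∸_; _≡ᵇ_; _<ᵇ_; s≤s; z≤n; NonZero)
import Data.Nat.DivMod as ℕ
import Data.Nat.Properties as ℕ
import Data.Nat.Tactic.RingSolver as ℕ-Solver
open import Data.Product using (_,_; proj₁)
import Data.Rational as ℚ
import Data.Rational.Properties as ℚ
import Data.Rational.Unnormalised as ℚᵘ
import Data.Rational.Unnormalised.Properties as ℚᵘ
open import Data.Sum using (inj₁; inj₂)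
open import Function.Bundles using (Equivalence)
open import Relation.Binary.Definitions using (tri<; tri≈; tri>)
open import Relation.Binary.PropositionalEquality hiding (J)
open ≡-Reasoning
open import Relation.Nullary using (¬_)
open import Relation.Nullary.Decidable using (dec-true; dec-false)

open import Defs

Jℤ : ℕ → ℤ
Jℤ zero = + 0
Jℤ (suc zero) = + 1
Jℤ (suc (suc n)) = Jℤ (suc n) + + 2 * Jℤ n

Jz≡Jℤ : ∀ n → Jz n ≡ Jℤ n
Jz≡Jℤ zero = refl
Jz≡Jℤ (suc zero) = refl
Jz≡Jℤ (suc (suc n)) = begin
  + (J (suc n) ℕ.+ 2 ℕ.* J n)        ≡⟨ ℤ.pos-+ (J (suc n)) (2 ℕ.* J n) ⟩
  Jz (suc n) + + (2 ℕ.* J n)         ≡⟨ cong (λ x → Jz (suc n) + x) (ℤ.pos-* 2 (J n)) ⟩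
  Jz (suc n) + + 2 * Jz n            ≡⟨ cong₂ (λ x y → x + + 2 * y) (Jz≡Jℤ (suc n)) (Jz≡Jℤ n) ⟩
  Jℤ (suc (suc n))                   ∎

Jℤ-+ : ∀ m n → Jℤ (m ℕ.+ n) ≡ Jℤ m * Jℤ (suc n) + Jℤ (suc m) * Jℤ n - Jℤ m * Jℤ n
Jℤ-+ zero n = lemma (Jℤ n) (Jℤ (suc n))
  where
  lemma : ∀ x₀ x₁ → x₀ ≡ + 0 * x₁ + + 1 * x₀ - + 0 * x₀
  lemma = solve-∀
Jℤ-+ (suc zero) n = lemma (Jℤ n) (Jℤ (suc n))
  where
  lemma : ∀ x₀ x₁ → x₁ ≡ + 1 * x₁ + + 1 * x₀ - + 1 * x₀
  lemma = solve-∀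
Jℤ-+ (suc (suc m)) n = begin
  Jℤ (suc m ℕ.+ n) + + 2 * Jℤ (m ℕ.+ n)
    ≡⟨ cong₂ (λ x y → x + + 2 * y) (Jℤ-+ (suc m) n) (Jℤ-+ m n) ⟩
  _ ≡⟨ lemma (Jℤ m) (Jℤ (suc m)) (Jℤ n) (Jℤ (suc n)) ⟩
  _ ∎
  where
  lemma : ∀ m₀ m₁ n₀ n₁ →
    (m₁ * n₁ + (m₁ + + 2 * m₀) * n₀ - m₁ * n₀) + + 2 * (m₀ * n₁ + m₁ * n₀ - m₀ * n₀)
      ≡ (m₁ + + 2 * m₀) * n₁ + ((m₁ + + 2 * m₀) + + 2 * m₁) * n₀ - (m₁ + + 2 * m₀) * n₀
  lemma = solve-∀

sgn-+ : ∀ m n → sgn (m ℕ.+ n) ≡ sgn m * sgn n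
sgn-+ zero n = sym (ℤ.*-identityˡ (sgn n))
sgn-+ (suc m) n = trans (cong -_ (sgn-+ m n)) (ℤ.neg-distribˡ-* (sgn m) (sgn n))

sgn-double-+ : ∀ k m n → k ≡ m ℕ.+ m ℕ.+ n → sgn k ≡ sgn n
sgn-double-+ _ m n refl = begin
  sgn (m ℕ.+ m ℕ.+ n)          ≡⟨ sgn-+ (m ℕ.+ m) n ⟩
  sgn (m ℕ.+ m) * sgn n        ≡⟨ cong (_* sgn n) (trans (sgn-+ m m) (sgn-square m)) ⟩
  + 1 * sgn n                  ≡⟨ ℤ.*-identityˡ (sgn n) ⟩
  sgn n                        ∎
  where
  sgn-square : ∀ m → sgn m * sgn m ≡ + 1
  sgn-square zero = refl
  sgn-square (suc m) = trans (negate-square (sgn m)) (sgn-square m)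
    where
    negate-square : ∀ s → (- s) * (- s) ≡ s * s
    negate-square = solve-∀

-- The numerators of HinvEntry, without its two special cases (see HinvEntry≡adj).
lowerNum upperNum adj : ℕ → ℕ → ℕ → ℤ
lowerNum N i j = Jz ((i ℕ.+ 1) ∸ j) * (Jz ((N ℕ.+ j) ∸ (i ℕ.+ 2)) + Jz ((N ℕ.+ j) ∸ (i ℕ.+ 1)))
                 - sgn (i ℕ.+ j) * Jz (j ∸ 1) * Jz (N ∸ (i ℕ.+ 1))
upperNum N i j = Jz i * Jz (N ∸ j) * (Jz (j ∸ (i ℕ.+ 1)) + Jz (j ∸ i))
adj N i j = if j <ᵇ i ℕ.+ 1 then lowerNum N i j else upperNum N i j

-- In adj-lower, w stands for r + t; it is a separate parameter so that each caller can
-- choose the syntactic form of w, and hence which Jacobsthal numbers appear as atoms.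
lowerEntry : ℕ → ℕ → ℕ → ℕ → ℤ
lowerEntry t p r w = Jℤ (suc p) * (Jℤ w + Jℤ (suc w)) - sgn p * Jℤ t * Jℤ r

upperEntry : ℕ → ℕ → ℕ → ℤ
upperEntry a q r = Jℤ a * Jℤ r * (Jℤ q + Jℤ (suc q))

Jz-∸ : ∀ m n o → m ≡ n ℕ.+ o → Jz (m ∸ n) ≡ Jℤ o
Jz-∸ _ n o refl = trans (cong Jz (ℕ.m+n∸m≡n n o)) (Jz≡Jℤ o)

adj-lower : ∀ N i t p r w → N ≡ 2 ℕ.+ t ℕ.+ p ℕ.+ r → i ≡ 1 ℕ.+ t ℕ.+ p → w ≡ r ℕ.+ t →
            adj N i (suc t) ≡ lowerEntry t p r w
adj-lower N i t p r w refl refl refl = begin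
  adj N i (suc t)
    ≡⟨ cong (λ b → if b then lowerNum N i (suc t) else upperNum N i (suc t))
            (dec-true (suc t ℕ.<? i ℕ.+ 1) below) ⟩
  lowerNum N i (suc t)
    ≡⟨ cong₂ _-_
         (cong₂ _*_ (Jz-∸ (i ℕ.+ 1) (suc t) (suc p) (ℕ-Solver.solve (t ∷ p ∷ [])))
                    (cong₂ _+_ (Jz-∸ (N ℕ.+ suc t) (i ℕ.+ 2) (r ℕ.+ t) (ℕ-Solver.solve (t ∷ p ∷ r ∷ [])))
                               (Jz-∸ (N ℕ.+ suc t) (i ℕ.+ 1) (suc (r ℕ.+ t)) (ℕ-Solver.solve (t ∷ p ∷ r ∷ [])))))
         (cong₂ _*_ (cong₂ _*_ (sgn-double-+ (i ℕ.+ suc t) (suc t) p (ℕ-Solver.solve (t ∷ p ∷ [])))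
                               (Jz≡Jℤ t))
                    (Jz-∸ N (i ℕ.+ 1) r (ℕ-Solver.solve (t ∷ p ∷ r ∷ [])))) ⟩
  lowerEntry t p r w ∎
  where
  below : suc t < i ℕ.+ 1
  below = s≤s (subst (suc t ≤_) (ℕ.+-comm 1 (t ℕ.+ p)) (s≤s (ℕ.m≤m+n t p)))

adj-upper : ∀ N j a q r → N ≡ 1 ℕ.+ a ℕ.+ q ℕ.+ r → j ≡ 1 ℕ.+ a ℕ.+ q →
            adj N a j ≡ upperEntry a q r
adj-upper N j a q r refl refl = begin
  adj N a j
    ≡⟨ cong (λ b → if b then lowerNum N a j else upperNum N a j) (dec-false (j ℕ.<? a ℕ.+ 1) notBelow) ⟩
  upperNum N a j
    ≡⟨ cong₂ _*_ (cong₂ _*_ (Jz≡Jℤ a) (Jz-∸ N j r (ℕ-Solver.solve (a ∷ q ∷ r ∷ []))))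
                 (cong₂ _+_ (Jz-∸ j (a ℕ.+ 1) q (ℕ-Solver.solve (a ∷ q ∷ [])))
                            (Jz-∸ j a (suc q) (ℕ-Solver.solve (a ∷ q ∷ [])))) ⟩
  upperEntry a q r ∎
  where
  notBelow : ¬ (j < a ℕ.+ 1)
  notBelow j<a+1 = ℕ.<⇒≱ j<a+1 (ℕ.≤-trans (ℕ.≤-reflexive (ℕ.+-comm a 1)) (s≤s (ℕ.m≤m+n a q)))

adj-corner : ∀ m → adj (2 ℕ.+ m) (1 ℕ.+ m) 1 ≡ Jz (1 ℕ.+ m)
adj-corner m = begin
  adj (2 ℕ.+ m) (1 ℕ.+ m) 1  ≡⟨ adj-lower (2 ℕ.+ m) (1 ℕ.+ m) 0 m 0 0 (ℕ-Solver.solve (m ∷ [])) refl refl ⟩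
  lowerEntry 0 m 0 0         ≡⟨ lemma (Jℤ (suc m)) (sgn m) ⟩
  Jℤ (1 ℕ.+ m)               ≡⟨ Jz≡Jℤ (1 ℕ.+ m) ⟨
  Jz (1 ℕ.+ m)               ∎
  where
  lemma : ∀ x s → x * (+ 0 + + 1) - s * + 0 * + 0 ≡ x
  lemma = solve-∀

adj-superdiag : ∀ i r → let N = suc (i ℕ.+ 1 ℕ.+ r) in
                adj N i (i ℕ.+ 1) ≡ Jz i * Jz (N ∸ (i ℕ.+ 1))
adj-superdiag i r = begin
  adj N i (i ℕ.+ 1)
    ≡⟨ adj-upper (suc (i ℕ.+ 1 ℕ.+ r)) (i ℕ.+ 1) i 0 (suc r)
                 (ℕ-Solver.solve (i ∷ r ∷ [])) (ℕ-Solver.solve (i ∷ [])) ⟩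
  upperEntry i 0 (suc r)  ≡⟨ lemma (Jℤ i) (Jℤ (suc r)) ⟩
  Jℤ i * Jℤ (suc r)       ≡⟨ cong₂ _*_ (Jz≡Jℤ i) (Jz-∸ N (i ℕ.+ 1) (suc r) (sym (ℕ.+-suc (i ℕ.+ 1) r))) ⟨
  Jz i * Jz (N ∸ (i ℕ.+ 1)) ∎
  where
  N = suc (i ℕ.+ 1 ℕ.+ r)
  lemma : ∀ x y → x * y * (+ 0 + + 1) ≡ x * y
  lemma = solve-∀

-- The special entries (n, 1) and (i, i + 1) of HinvEntry are instances of the generic
-- lower and upper formulas.
HinvEntry≡adj : ∀ n i j → 1 ≤ n → j ≤ n → HinvEntry (suc n) i j ≡ divJ (adj (suc n) i j) (suc n)
HinvEntry≡adj n i j 1≤n j≤n with (i ≡ᵇ n) ∧ (j ≡ᵇ 1) in corner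
... | true with Equivalence.to T-∧ (subst T (sym corner) _)
...   | i≡ᵇn , j≡ᵇ1 with ℕ.≡ᵇ⇒≡ i n i≡ᵇn | ℕ.≡ᵇ⇒≡ j 1 j≡ᵇ1 | 1≤n
...     | refl | refl | s≤s _ = cong (λ z → divJ z (suc n)) (sym (adj-corner (ℕ.pred n)))
HinvEntry≡adj n i j 1≤n j≤n | false with j ≡ᵇ i ℕ.+ 1 in superdiag
... | true with ℕ.≡ᵇ⇒≡ j (i ℕ.+ 1) (subst T (sym superdiag) _)
...   | refl with ℕ.m≤n⇒∃[o]m+o≡n j≤n
...     | r , refl = cong (λ z → divJ z (suc n)) (sym (adj-superdiag i r))
HinvEntry≡adj n i j 1≤n j≤n | false | false = sym (if-float (λ z → divJ z (suc n)) (j <ᵇ i ℕ.+ 1))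

adj-last-column : ∀ n a → a ≤ n → adj (suc n) a (suc n) ≡ + 0
adj-last-column n a a≤n with ℕ.m≤n⇒∃[o]m+o≡n a≤n
... | q , refl = begin
  adj (suc (a ℕ.+ q)) a (suc (a ℕ.+ q))
    ≡⟨ adj-upper (suc (a ℕ.+ q)) (suc (a ℕ.+ q)) a q 0 (ℕ-Solver.solve (a ∷ q ∷ [])) refl ⟩
  Jℤ a * + 0 * (Jℤ q + Jℤ (suc q))
    ≡⟨ cong (_* (Jℤ q + Jℤ (suc q))) (ℤ.*-zeroʳ (Jℤ a)) ⟩
  + 0 ∎

𝟙 : Bool → ℤ
𝟙 true = + 1
𝟙 false = + 0

-- The entry H (suc n) a k for 1 ≤ a, k ≤ n: modulo n + 1, k + 1 ≡ a means a ≡ k + 1,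
-- while k + 2 ≡ a means a ≡ k + 2 or the wrap-around (a, k) ≡ (1, n).
hℤ : ℕ → ℕ → ℕ → ℤ
hℤ n a k = + 2 * 𝟙 (a ≡ᵇ k) - 𝟙 (a ≡ᵇ suc k) - 𝟙 (a ≡ᵇ suc (suc k)) - 𝟙 (a ≡ᵇ 1) * 𝟙 (n ≡ᵇ k)

≡ᵇ-sym : ∀ m n → (m ≡ᵇ n) ≡ (n ≡ᵇ m)
≡ᵇ-sym zero zero = refl
≡ᵇ-sym zero (suc n) = refl
≡ᵇ-sym (suc m) zero = refl
≡ᵇ-sym (suc m) (suc n) = ≡ᵇ-sym m n

≡ᵇ-true : ∀ {m n} → m ≡ n → (m ≡ᵇ n) ≡ true
≡ᵇ-true {m} {n} = dec-true (m ℕ.≟ n)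

≡ᵇ-false : ∀ {m n} → m ≢ n → (m ≡ᵇ n) ≡ false
≡ᵇ-false {m} {n} = dec-false (m ℕ.≟ n)

mod-succ : ∀ n a k → 1 ≤ a → a ≤ n → k ≤ n → modEq (suc n) (k ℕ.+ 1) a ≡ (a ≡ᵇ suc k)
mod-succ n (suc a) k _ a<n k≤n
  rewrite ℕ.m<n⇒m%n≡m (s≤s a<n) | ℕ.+-comm k 1 with ℕ.m≤n⇒m<n∨m≡n k≤n
... | inj₁ k<n rewrite ℕ.m<n⇒m%n≡m (s≤s k<n) = ≡ᵇ-sym k a
... | inj₂ refl rewrite ℕ.n%n≡0 (suc k) {{_}} = sym (≡ᵇ-false (ℕ.<⇒≢ a<n))

mod-succ-succ : ∀ n a k → 2 ≤ n → 1 ≤ a → a ≤ n → 1 ≤ k → k ≤ n →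
                modEq (suc n) (k ℕ.+ 2) a ≡ (a ≡ᵇ suc (suc k)) ∨ ((a ≡ᵇ 1) ∧ (n ≡ᵇ k))
mod-succ-succ n (suc a) k 2≤n _ a<n _ k≤n
  rewrite ℕ.m<n⇒m%n≡m (s≤s a<n) | ℕ.+-comm k 2 with ℕ.m≤n⇒m<n∨m≡n k≤n
... | inj₂ refl rewrite ℕ.[m+n]%n≡m%n 1 (suc k) {{_}}
                      | ℕ.m<n⇒m%n≡m {m = 1} (s≤s (ℕ.≤-trans (ℕ.n≤1+n 1) 2≤n))
                      | ≡ᵇ-true {k} refl | ≡ᵇ-false (ℕ.<⇒≢ (ℕ.m<n⇒m<1+n a<n))
                      | ∧-identityʳ (a ≡ᵇ 0) = ≡ᵇ-sym 0 a
... | inj₁ k<n with ℕ.m≤n⇒m<n∨m≡n k<n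
...   | inj₁ 1+k<n rewrite ℕ.m<n⇒m%n≡m (s≤s 1+k<n) | ≡ᵇ-false (ℕ.>⇒≢ k<n)
                         | ∧-zeroʳ (a ≡ᵇ 0) | ∨-identityʳ (a ≡ᵇ suc k) = ≡ᵇ-sym (suc k) a
...   | inj₂ refl rewrite ℕ.n%n≡0 (suc (suc k)) {{_}} | ≡ᵇ-false (ℕ.>⇒≢ k<n)
                        | ≡ᵇ-false (ℕ.<⇒≢ a<n) | ∧-zeroʳ (a ≡ᵇ 0) = refl

Disjoint : Bool → Bool → Set
Disjoint x y = T x → T y → ⊥

disjoint-∨ : ∀ {x y z} → Disjoint x y → Disjoint x z → Disjoint x (y ∨ z)
disjoint-∨ {y = y} {z} x#y x#z tx ty∨z with Equivalence.to (T-∨ {y} {z}) ty∨z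
... | inj₁ ty = x#y tx ty
... | inj₂ tz = x#z tx tz

disjoint-∧ʳ : ∀ {x y z} → (T x → T y → ⊥) → Disjoint x (y ∧ z)
disjoint-∧ʳ {y = y} {z} x#y tx ty∧z = x#y tx (proj₁ (Equivalence.to (T-∧ {y} {z}) ty∧z))

𝟙-∨ : ∀ x y → Disjoint x y → 𝟙 (x ∨ y) ≡ 𝟙 x + 𝟙 y
𝟙-∨ true true x#y = ⊥-elim (x#y _ _)
𝟙-∨ true false _ = refl
𝟙-∨ false true _ = refl
𝟙-∨ false false _ = refl

𝟙-∧ : ∀ x y → 𝟙 (x ∧ y) ≡ 𝟙 x * 𝟙 y
𝟙-∧ true true = refl
𝟙-∧ true false = refl
𝟙-∧ false _ = refl

if-indicator : ∀ x y → Disjoint x y →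
  (if x then ℚ.1ℚ ℚ.+ ℚ.1ℚ else if y then ℚ.- ℚ.1ℚ else ℚ.0ℚ) ≡ (+ 2 * 𝟙 x - 𝟙 y) ℚ./ 1
if-indicator true true x#y = ⊥-elim (x#y _ _)
if-indicator true false _ = refl
if-indicator false true _ = refl
if-indicator false false _ = refl

Hentry≡hℤ : ∀ n a k → 2 ≤ n → 1 ≤ a → a ≤ n → 1 ≤ k → k ≤ n →
            Hentry (suc n) a k ≡ hℤ n a k ℚ./ 1
Hentry≡hℤ n a k 2≤n 1≤a a≤n 1≤k k≤n = begin
  Hentry (suc n) a k
    ≡⟨ cong₂ (λ x y → if a ≡ᵇ k then ℚ.1ℚ ℚ.+ ℚ.1ℚ else if x ∨ y then ℚ.- ℚ.1ℚ else ℚ.0ℚ)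
             (mod-succ n a k 1≤a a≤n k≤n) (mod-succ-succ n a k 2≤n 1≤a a≤n 1≤k k≤n) ⟩
  (if b₁ then ℚ.1ℚ ℚ.+ ℚ.1ℚ else if b₂ ∨ (b₃ ∨ (b₄ ∧ b₅)) then ℚ.- ℚ.1ℚ else ℚ.0ℚ)
    ≡⟨ if-indicator b₁ _ (disjoint-∨ 1#2 (disjoint-∨ 1#3 1#4)) ⟩
  (+ 2 * 𝟙 b₁ - 𝟙 (b₂ ∨ (b₃ ∨ (b₄ ∧ b₅)))) ℚ./ 1
    ≡⟨ cong (λ z → (+ 2 * 𝟙 b₁ - z) ℚ./ 1) (begin
         𝟙 (b₂ ∨ (b₃ ∨ (b₄ ∧ b₅)))     ≡⟨ 𝟙-∨ b₂ _ (disjoint-∨ 2#3 (disjoint-∧ʳ 2#4)) ⟩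
         𝟙 b₂ + 𝟙 (b₃ ∨ (b₄ ∧ b₅))     ≡⟨ cong (λ z → 𝟙 b₂ + z) (𝟙-∨ b₃ _ (disjoint-∧ʳ 3#4)) ⟩
         𝟙 b₂ + (𝟙 b₃ + 𝟙 (b₄ ∧ b₅))   ≡⟨ cong (λ z → 𝟙 b₂ + (𝟙 b₃ + z)) (𝟙-∧ b₄ b₅) ⟩
         𝟙 b₂ + (𝟙 b₃ + 𝟙 b₄ * 𝟙 b₅)   ∎) ⟩
  (+ 2 * 𝟙 b₁ - (𝟙 b₂ + (𝟙 b₃ + 𝟙 b₄ * 𝟙 b₅))) ℚ./ 1
    ≡⟨ cong (ℚ._/ 1) (lemma (𝟙 b₁) (𝟙 b₂) (𝟙 b₃) (𝟙 b₄) (𝟙 b₅)) ⟩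
  hℤ n a k ℚ./ 1 ∎
  where
  b₁ = a ≡ᵇ k
  b₂ = a ≡ᵇ suc k
  b₃ = a ≡ᵇ suc (suc k)
  b₄ = a ≡ᵇ 1
  b₅ = n ≡ᵇ k
  lemma : ∀ x y z u v → + 2 * x - (y + (z + u * v)) ≡ + 2 * x - y - z - u * v
  lemma = solve-∀
  eq : ∀ {m m′} → T (a ≡ᵇ m) → T (a ≡ᵇ m′) → m ≡ m′
  eq {m} {m′} p q = trans (sym (ℕ.≡ᵇ⇒≡ a m p)) (ℕ.≡ᵇ⇒≡ a m′ q)
  1#2 : Disjoint b₁ b₂
  1#2 p q = ℕ.<⇒≢ (ℕ.n<1+n k) (eq p q)
  1#3 : Disjoint b₁ b₃
  1#3 p q = ℕ.<⇒≢ (ℕ.m<n⇒m<1+n (ℕ.n<1+n k)) (eq p q)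
  1#4 : Disjoint b₁ (b₄ ∧ b₅)
  1#4 p q with Equivalence.to (T-∧ {b₄} {b₅}) q
  ... | a≡1 , n≡k = ℕ.<⇒≱ 2≤n (ℕ.≤-reflexive (trans (ℕ.≡ᵇ⇒≡ n k n≡k) (eq p a≡1)))
  2#3 : Disjoint b₂ b₃
  2#3 p q = ℕ.<⇒≢ (ℕ.n<1+n (suc k)) (eq p q)
  2#4 : Disjoint b₂ b₄
  2#4 p q = ℕ.<⇒≢ 1≤k (sym (ℕ.suc-injective (eq p q)))
  3#4 : Disjoint b₃ b₄
  3#4 p q = ℕ.0≢1+n (sym (ℕ.suc-injective (eq p q)))

-- Rows and columns of H acting on a vector

sumℕ : ℕ → (ℕ → ℤ) → ℤ
sumℕ zero f = + 0
sumℕ (suc n) f = f 0 + sumℕ n (λ k → f (suc k))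

sumℕ-cong : ∀ n {f g : ℕ → ℤ} → (∀ k → f k ≡ g k) → sumℕ n f ≡ sumℕ n g
sumℕ-cong zero f≗g = refl
sumℕ-cong (suc n) f≗g = cong₂ _+_ (f≗g 0) (sumℕ-cong n (λ k → f≗g (suc k)))

sumℕ-zero : ∀ n → sumℕ n (λ _ → + 0) ≡ + 0
sumℕ-zero zero = refl
sumℕ-zero (suc n) = trans (ℤ.+-identityˡ _) (sumℕ-zero n)

sumℕ-δ : ∀ n c (Y : ℕ → ℤ) → c < n → sumℕ n (λ k → 𝟙 (c ≡ᵇ k) * Y k) ≡ Y c
sumℕ-δ (suc n) zero Y _ = begin
  + 1 * Y 0 + sumℕ n (λ _ → + 0)  ≡⟨ cong₂ _+_ (ℤ.*-identityˡ (Y 0)) (sumℕ-zero n) ⟩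
  Y 0 + + 0                       ≡⟨ ℤ.+-identityʳ (Y 0) ⟩
  Y 0                             ∎
sumℕ-δ (suc n) (suc c) Y (s≤s c<n) =
  trans (ℤ.+-identityˡ _) (sumℕ-δ n c (λ k → Y (suc k)) c<n)

sumℕ-δ-out : ∀ n c (Y : ℕ → ℤ) → n ≤ c → sumℕ n (λ k → 𝟙 (c ≡ᵇ k) * Y k) ≡ + 0
sumℕ-δ-out zero c Y _ = refl
sumℕ-δ-out (suc n) (suc c) Y (s≤s n≤c) =
  trans (ℤ.+-identityˡ _) (sumℕ-δ-out n c (λ k → Y (suc k)) n≤c)

sumℕ-δ-pred : ∀ n c (Y : ℕ → ℤ) → c ≤ n → Y 0 ≡ + 0 →
              sumℕ n (λ k → 𝟙 (c ≡ᵇ suc k) * Y (suc k)) ≡ Y c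
sumℕ-δ-pred n zero Y _ Y₀≡0 = trans (sumℕ-zero n) (sym Y₀≡0)
sumℕ-δ-pred n (suc c) Y c<n _ = sumℕ-δ n c (λ k → Y (suc k)) c<n

sumℕ-δ-upTo : ∀ n c (Y : ℕ → ℤ) → c ≤ n → Y n ≡ + 0 →
              sumℕ n (λ k → 𝟙 (c ≡ᵇ k) * Y k) ≡ Y c
sumℕ-δ-upTo n c Y c≤n Yₙ≡0 with ℕ.m≤n⇒m<n∨m≡n c≤n
... | inj₁ c<n = sumℕ-δ n c Y c<n
... | inj₂ refl = trans (sumℕ-δ-out n n Y ℕ.≤-refl) (sym Yₙ≡0)

sumℕ-combination : ∀ n c (f g h e : ℕ → ℤ) →
  sumℕ n (λ k → + 2 * f k - g k - h k - c * e k) ≡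
  + 2 * sumℕ n f - sumℕ n g - sumℕ n h - c * sumℕ n e
sumℕ-combination zero c f g h e = lemma c
  where
  lemma : ∀ c → + 0 ≡ + 2 * + 0 - + 0 - + 0 - c * + 0
  lemma = solve-∀
sumℕ-combination (suc n) c f g h e = begin
  + 2 * f 0 - g 0 - h 0 - c * e 0 + sumℕ n (λ k → + 2 * f (suc k) - g (suc k) - h (suc k) - c * e (suc k))
    ≡⟨ cong (λ z → + 2 * f 0 - g 0 - h 0 - c * e 0 + z)
            (sumℕ-combination n c (λ k → f (suc k)) (λ k → g (suc k)) (λ k → h (suc k)) (λ k → e (suc k))) ⟩
  + 2 * f 0 - g 0 - h 0 - c * e 0 + (+ 2 * Σf - Σg - Σh - c * Σe)
    ≡⟨ lemma c (f 0) (g 0) (h 0) (e 0) Σf Σg Σh Σe ⟩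
  + 2 * (f 0 + Σf) - (g 0 + Σg) - (h 0 + Σh) - c * (e 0 + Σe) ∎
  where
  Σf = sumℕ n (λ k → f (suc k))
  Σg = sumℕ n (λ k → g (suc k))
  Σh = sumℕ n (λ k → h (suc k))
  Σe = sumℕ n (λ k → e (suc k))
  lemma : ∀ c f g h e F G H E →
    + 2 * f - g - h - c * e + (+ 2 * F - G - H - c * E) ≡ + 2 * (f + F) - (g + G) - (h + H) - c * (e + E)
  lemma = solve-∀

2x-y-z : ℤ → ℤ → ℤ → ℤ
2x-y-z x y z = + 2 * x - y - z

2x-y-z-cong : ∀ {x x′ y y′ z z′} → x ≡ x′ → y ≡ y′ → z ≡ z′ → 2x-y-z x y z ≡ 2x-y-z x′ y′ z′
2x-y-z-cong refl refl refl = refl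

rowSum-expand : ∀ n a (X : ℕ → ℤ) →
  sumℕ n (λ k → hℤ n a (suc k) * X (suc k)) ≡
  + 2 * sumℕ n (λ k → 𝟙 (a ≡ᵇ suc k) * X (suc k))
      - sumℕ n (λ k → 𝟙 (a ≡ᵇ suc (suc k)) * X (suc k))
      - sumℕ n (λ k → 𝟙 (a ≡ᵇ suc (suc (suc k))) * X (suc k))
      - 𝟙 (a ≡ᵇ 1) * sumℕ n (λ k → 𝟙 (n ≡ᵇ suc k) * X (suc k))
rowSum-expand n a X = trans
  (sumℕ-cong n (λ k → lemma (𝟙 (a ≡ᵇ suc k)) (𝟙 (a ≡ᵇ suc (suc k))) (𝟙 (a ≡ᵇ suc (suc (suc k))))
                            (𝟙 (a ≡ᵇ 1)) (𝟙 (n ≡ᵇ suc k)) (X (suc k))))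
  (sumℕ-combination n (𝟙 (a ≡ᵇ 1)) _ _ _ _)
  where
  lemma : ∀ d₁ d₂ d₃ d₄ d₅ x → (+ 2 * d₁ - d₂ - d₃ - d₄ * d₅) * x ≡
                               + 2 * (d₁ * x) - d₂ * x - d₃ * x - d₄ * (d₅ * x)
  lemma = solve-∀

rowSum-first : ∀ m (X : ℕ → ℤ) →
  sumℕ (suc m) (λ k → hℤ (suc m) 1 (suc k) * X (suc k)) ≡ + 2 * X 1 - X (suc m)
rowSum-first m X = begin
  sumℕ (suc m) (λ k → hℤ (suc m) 1 (suc k) * X (suc k))
    ≡⟨ rowSum-expand (suc m) 1 X ⟩
  + 2 * sumℕ (suc m) (λ k → 𝟙 (0 ≡ᵇ k) * X (suc k)) - sumℕ (suc m) (λ _ → + 0) - sumℕ (suc m) (λ _ → + 0)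
      - + 1 * sumℕ (suc m) (λ k → 𝟙 (m ≡ᵇ k) * X (suc k))
    ≡⟨ cong₂ (λ x y → + 2 * x - sumℕ (suc m) (λ _ → + 0) - sumℕ (suc m) (λ _ → + 0) - + 1 * y)
             (sumℕ-δ (suc m) 0 (λ k → X (suc k)) (s≤s z≤n))
             (sumℕ-δ (suc m) m (λ k → X (suc k)) (ℕ.n<1+n m)) ⟩
  + 2 * X 1 - sumℕ (suc m) (λ _ → + 0) - sumℕ (suc m) (λ _ → + 0) - + 1 * X (suc m)
    ≡⟨ cong (λ z → + 2 * X 1 - z - z - + 1 * X (suc m)) (sumℕ-zero (suc m)) ⟩
  + 2 * X 1 - + 0 - + 0 - + 1 * X (suc m)
    ≡⟨ lemma (X 1) (X (suc m)) ⟩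
  + 2 * X 1 - X (suc m) ∎
  where
  lemma : ∀ x y → + 2 * x - + 0 - + 0 - + 1 * y ≡ + 2 * x - y
  lemma = solve-∀

rowSum : ∀ n c (X : ℕ → ℤ) → 2 ℕ.+ c ≤ n → X 0 ≡ + 0 →
  sumℕ n (λ k → hℤ n (2 ℕ.+ c) (suc k) * X (suc k)) ≡ 2x-y-z (X (2 ℕ.+ c)) (X (1 ℕ.+ c)) (X c)
rowSum n c X 2+c≤n X₀≡0 = begin
  sumℕ n (λ k → hℤ n (2 ℕ.+ c) (suc k) * X (suc k))
    ≡⟨ rowSum-expand n (2 ℕ.+ c) X ⟩
  2x-y-z (sumℕ n (λ k → 𝟙 (suc c ≡ᵇ k) * X (suc k))) (sumℕ n (λ k → 𝟙 (c ≡ᵇ k) * X (suc k)))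
         (sumℕ n (λ k → 𝟙 (c ≡ᵇ suc k) * X (suc k))) - + 0
    ≡⟨ cong (_- + 0) (2x-y-z-cong (sumℕ-δ n (suc c) (λ k → X (suc k)) 2+c≤n)
                                  (sumℕ-δ n c (λ k → X (suc k)) (ℕ.<-trans (ℕ.n<1+n c) 2+c≤n))
                                  (sumℕ-δ-pred n c X (ℕ.<⇒≤ (ℕ.<-trans (ℕ.n<1+n c) 2+c≤n)) X₀≡0)) ⟩
  2x-y-z (X (2 ℕ.+ c)) (X (1 ℕ.+ c)) (X c) - + 0
    ≡⟨ ℤ.+-identityʳ _ ⟩
  2x-y-z (X (2 ℕ.+ c)) (X (1 ℕ.+ c)) (X c) ∎

colSum-expand : ∀ n b (Y : ℕ → ℤ) →
  sumℕ n (λ k → Y (suc k) * hℤ n (suc k) b) ≡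
  + 2 * sumℕ n (λ k → 𝟙 (b ≡ᵇ suc k) * Y (suc k))
      - sumℕ n (λ k → 𝟙 (b ≡ᵇ k) * Y (suc k))
      - sumℕ n (λ k → 𝟙 (suc b ≡ᵇ k) * Y (suc k))
      - 𝟙 (n ≡ᵇ b) * sumℕ n (λ k → 𝟙 (0 ≡ᵇ k) * Y (suc k))
colSum-expand n b Y = trans (sumℕ-cong n term) (sumℕ-combination n (𝟙 (n ≡ᵇ b)) _ _ _ _)
  where
  lemma : ∀ d₁ d₂ d₃ d₄ d₅ y → y * (+ 2 * d₁ - d₂ - d₃ - d₄ * d₅) ≡
                               + 2 * (d₁ * y) - d₂ * y - d₃ * y - d₅ * (d₄ * y)
  lemma = solve-∀
  term : ∀ k → Y (suc k) * hℤ n (suc k) b ≡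
         + 2 * (𝟙 (b ≡ᵇ suc k) * Y (suc k)) - 𝟙 (b ≡ᵇ k) * Y (suc k)
           - 𝟙 (suc b ≡ᵇ k) * Y (suc k) - 𝟙 (n ≡ᵇ b) * (𝟙 (0 ≡ᵇ k) * Y (suc k))
  term k rewrite ≡ᵇ-sym b (suc k) | ≡ᵇ-sym b k | ≡ᵇ-sym (suc b) k | ≡ᵇ-sym 0 k =
    lemma (𝟙 (suc k ≡ᵇ b)) (𝟙 (k ≡ᵇ b)) (𝟙 (k ≡ᵇ suc b)) (𝟙 (k ≡ᵇ 0)) (𝟙 (n ≡ᵇ b)) (Y (suc k))

colSum-last : ∀ m (Y : ℕ → ℤ) →
  sumℕ (suc m) (λ k → Y (suc k) * hℤ (suc m) (suc k) (suc m)) ≡ + 2 * Y (suc m) - Y 1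
colSum-last m Y = begin
  sumℕ (suc m) (λ k → Y (suc k) * hℤ (suc m) (suc k) (suc m))
    ≡⟨ colSum-expand (suc m) (suc m) Y ⟩
  2x-y-z (sumℕ (suc m) (λ k → 𝟙 (m ≡ᵇ k) * Y (suc k))) (sumℕ (suc m) (λ k → 𝟙 (suc m ≡ᵇ k) * Y (suc k)))
         (sumℕ (suc m) (λ k → 𝟙 (suc (suc m) ≡ᵇ k) * Y (suc k)))
    - 𝟙 (m ≡ᵇ m) * sumℕ (suc m) (λ k → 𝟙 (0 ≡ᵇ k) * Y (suc k))
    ≡⟨ cong₂ _-_ (2x-y-z-cong (sumℕ-δ (suc m) m Y′ (ℕ.n<1+n m))
                              (sumℕ-δ-out (suc m) (suc m) Y′ ℕ.≤-refl)
                              (sumℕ-δ-out (suc m) (suc (suc m)) Y′ (ℕ.n≤1+n (suc m))))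
                 (cong₂ _*_ (cong 𝟙 (≡ᵇ-true {m} refl)) (sumℕ-δ (suc m) 0 Y′ (s≤s z≤n))) ⟩
  2x-y-z (Y (suc m)) (+ 0) (+ 0) - + 1 * Y 1
    ≡⟨ lemma (Y (suc m)) (Y 1) ⟩
  + 2 * Y (suc m) - Y 1 ∎
  where
  Y′ : ℕ → ℤ
  Y′ k = Y (suc k)
  lemma : ∀ x y → + 2 * x - + 0 - + 0 - + 1 * y ≡ + 2 * x - y
  lemma = solve-∀

colSum : ∀ n b (Y : ℕ → ℤ) → 1 ≤ b → b < n → Y (suc n) ≡ + 0 →
  sumℕ n (λ k → Y (suc k) * hℤ n (suc k) b) ≡ 2x-y-z (Y b) (Y (suc b)) (Y (suc (suc b)))
colSum n (suc b) Y _ b<n Y₁₊ₙ≡0 = begin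
  sumℕ n (λ k → Y (suc k) * hℤ n (suc k) (suc b))
    ≡⟨ colSum-expand n (suc b) Y ⟩
  2x-y-z (sumℕ n (λ k → 𝟙 (b ≡ᵇ k) * Y′ k)) (sumℕ n (λ k → 𝟙 (suc b ≡ᵇ k) * Y′ k))
         (sumℕ n (λ k → 𝟙 (suc (suc b) ≡ᵇ k) * Y′ k))
    - 𝟙 (n ≡ᵇ suc b) * sumℕ n (λ k → 𝟙 (0 ≡ᵇ k) * Y′ k)
    ≡⟨ cong₂ _-_ (2x-y-z-cong (sumℕ-δ n b Y′ (ℕ.<-trans (ℕ.n<1+n b) b<n))
                              (sumℕ-δ n (suc b) Y′ b<n)
                              (sumℕ-δ-upTo n (suc (suc b)) Y′ b<n Y₁₊ₙ≡0))
                 (cong (λ z → 𝟙 z * sumℕ n (λ k → 𝟙 (0 ≡ᵇ k) * Y′ k)) (≡ᵇ-false (ℕ.>⇒≢ b<n))) ⟩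
  2x-y-z (Y (suc b)) (Y (suc (suc b))) (Y (suc (suc (suc b)))) - + 0
    ≡⟨ ℤ.+-identityʳ _ ⟩
  2x-y-z (Y (suc b)) (Y (suc (suc b))) (Y (suc (suc (suc b)))) ∎
  where
  Y′ : ℕ → ℤ
  Y′ k = Y (suc k)

-- The local recurrences satisfied by adj

H·adj-first-diag : ∀ m → + 2 * adj (3 ℕ.+ m) 1 1 - adj (3 ℕ.+ m) (2 ℕ.+ m) 1 ≡ Jz (3 ℕ.+ m)
H·adj-first-diag m = begin
  + 2 * adj (3 ℕ.+ m) 1 1 - adj (3 ℕ.+ m) (2 ℕ.+ m) 1
    ≡⟨ cong₂ (λ x y → + 2 * x - y)
         (adj-lower (3 ℕ.+ m) 1 0 0 (1 ℕ.+ m) (1 ℕ.+ m) refl refl (ℕ-Solver.solve (m ∷ [])))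
         (adj-lower (3 ℕ.+ m) (2 ℕ.+ m) 0 (1 ℕ.+ m) 0 0 (ℕ-Solver.solve (m ∷ [])) refl refl) ⟩
  + 2 * lowerEntry 0 0 (1 ℕ.+ m) (1 ℕ.+ m) - lowerEntry 0 (1 ℕ.+ m) 0 0
    ≡⟨ lemma (Jℤ m) (Jℤ (suc m)) (sgn m) ⟩
  Jℤ (3 ℕ.+ m)
    ≡⟨ Jz≡Jℤ (3 ℕ.+ m) ⟨
  Jz (3 ℕ.+ m) ∎
  where
  lemma : ∀ m₀ m₁ s → let m₂ = m₁ + + 2 * m₀ in
    + 2 * (+ 1 * (m₁ + m₂) - + 1 * + 0 * m₁) - (m₂ * (+ 0 + + 1) - (- s) * + 0 * + 0) ≡ m₂ + + 2 * m₁
  lemma = solve-∀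

H·adj-first-off : ∀ q r →
  + 2 * adj (3 ℕ.+ q ℕ.+ r) 1 (2 ℕ.+ q) - adj (3 ℕ.+ q ℕ.+ r) (2 ℕ.+ q ℕ.+ r) (2 ℕ.+ q) ≡ + 0
H·adj-first-off q r = begin
  + 2 * adj (3 ℕ.+ q ℕ.+ r) 1 (2 ℕ.+ q) - adj (3 ℕ.+ q ℕ.+ r) (2 ℕ.+ q ℕ.+ r) (2 ℕ.+ q)
    ≡⟨ cong₂ (λ x y → + 2 * x - y)
         (adj-upper (3 ℕ.+ q ℕ.+ r) (2 ℕ.+ q) 1 q (1 ℕ.+ r) (ℕ-Solver.solve (q ∷ r ∷ [])) refl)
         (adj-lower (3 ℕ.+ q ℕ.+ r) (2 ℕ.+ q ℕ.+ r) (1 ℕ.+ q) r 0 (1 ℕ.+ q)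
                    (ℕ-Solver.solve (q ∷ r ∷ [])) refl refl) ⟩
  + 2 * upperEntry 1 q (1 ℕ.+ r) - lowerEntry (1 ℕ.+ q) r 0 (1 ℕ.+ q)
    ≡⟨ lemma (Jℤ q) (Jℤ (suc q)) (Jℤ (suc r)) (sgn r) ⟩
  + 0 ∎
  where
  lemma : ∀ q₀ q₁ r₁ s → let q₂ = q₁ + + 2 * q₀ in
    + 2 * (+ 1 * r₁ * (q₀ + q₁)) - (r₁ * (q₁ + q₂) - s * q₁ * + 0) ≡ + 0
  lemma = solve-∀

H·adj-upper : ∀ c q r →
  2x-y-z (adj (4 ℕ.+ c ℕ.+ q ℕ.+ r) (2 ℕ.+ c) (3 ℕ.+ c ℕ.+ q))
         (adj (4 ℕ.+ c ℕ.+ q ℕ.+ r) (1 ℕ.+ c) (3 ℕ.+ c ℕ.+ q))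
         (adj (4 ℕ.+ c ℕ.+ q ℕ.+ r) c (3 ℕ.+ c ℕ.+ q)) ≡ + 0
H·adj-upper c q r = begin
  2x-y-z (adj (4 ℕ.+ c ℕ.+ q ℕ.+ r) (2 ℕ.+ c) (3 ℕ.+ c ℕ.+ q))
         (adj (4 ℕ.+ c ℕ.+ q ℕ.+ r) (1 ℕ.+ c) (3 ℕ.+ c ℕ.+ q))
         (adj (4 ℕ.+ c ℕ.+ q ℕ.+ r) c (3 ℕ.+ c ℕ.+ q))
    ≡⟨ 2x-y-z-cong
         (adj-upper (4 ℕ.+ c ℕ.+ q ℕ.+ r) (3 ℕ.+ c ℕ.+ q) (2 ℕ.+ c) q (1 ℕ.+ r)
                    (ℕ-Solver.solve (c ∷ q ∷ r ∷ [])) refl)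
         (adj-upper (4 ℕ.+ c ℕ.+ q ℕ.+ r) (3 ℕ.+ c ℕ.+ q) (1 ℕ.+ c) (1 ℕ.+ q) (1 ℕ.+ r)
                    (ℕ-Solver.solve (c ∷ q ∷ r ∷ [])) (ℕ-Solver.solve (c ∷ q ∷ [])))
         (adj-upper (4 ℕ.+ c ℕ.+ q ℕ.+ r) (3 ℕ.+ c ℕ.+ q) c (2 ℕ.+ q) (1 ℕ.+ r)
                    (ℕ-Solver.solve (c ∷ q ∷ r ∷ [])) (ℕ-Solver.solve (c ∷ q ∷ []))) ⟩
  2x-y-z (upperEntry (2 ℕ.+ c) q (1 ℕ.+ r)) (upperEntry (1 ℕ.+ c) (1 ℕ.+ q) (1 ℕ.+ r))
         (upperEntry c (2 ℕ.+ q) (1 ℕ.+ r))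
    ≡⟨ lemma (Jℤ c) (Jℤ (suc c)) (Jℤ q) (Jℤ (suc q)) (Jℤ (suc r)) ⟩
  + 0 ∎
  where
  lemma : ∀ c₀ c₁ q₀ q₁ r₁ → let c₂ = c₁ + + 2 * c₀; q₂ = q₁ + + 2 * q₀; q₃ = q₂ + + 2 * q₁ in
    + 2 * (c₂ * r₁ * (q₀ + q₁)) - c₁ * r₁ * (q₁ + q₂) - c₀ * r₁ * (q₂ + q₃) ≡ + 0
  lemma = solve-∀

H·adj-diag : ∀ c r →
  2x-y-z (adj (3 ℕ.+ c ℕ.+ r) (2 ℕ.+ c) (2 ℕ.+ c)) (adj (3 ℕ.+ c ℕ.+ r) (1 ℕ.+ c) (2 ℕ.+ c))
         (adj (3 ℕ.+ c ℕ.+ r) c (2 ℕ.+ c)) ≡ Jz (3 ℕ.+ c ℕ.+ r)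
H·adj-diag c r = begin
  2x-y-z (adj (3 ℕ.+ c ℕ.+ r) (2 ℕ.+ c) (2 ℕ.+ c)) (adj (3 ℕ.+ c ℕ.+ r) (1 ℕ.+ c) (2 ℕ.+ c))
         (adj (3 ℕ.+ c ℕ.+ r) c (2 ℕ.+ c))
    ≡⟨ 2x-y-z-cong
         (adj-lower (3 ℕ.+ c ℕ.+ r) (2 ℕ.+ c) (1 ℕ.+ c) 0 r (1 ℕ.+ (r ℕ.+ c))
                    (ℕ-Solver.solve (c ∷ r ∷ [])) (ℕ-Solver.solve (c ∷ [])) (ℕ-Solver.solve (c ∷ r ∷ [])))
         (adj-upper (3 ℕ.+ c ℕ.+ r) (2 ℕ.+ c) (1 ℕ.+ c) 0 (1 ℕ.+ r)
                    (ℕ-Solver.solve (c ∷ r ∷ [])) (ℕ-Solver.solve (c ∷ [])))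
         (adj-upper (3 ℕ.+ c ℕ.+ r) (2 ℕ.+ c) c 1 (1 ℕ.+ r)
                    (ℕ-Solver.solve (c ∷ r ∷ [])) (ℕ-Solver.solve (c ∷ []))) ⟩
  2x-y-z (lowerEntry (1 ℕ.+ c) 0 r (1 ℕ.+ (r ℕ.+ c))) (upperEntry (1 ℕ.+ c) 0 (1 ℕ.+ r))
         (upperEntry c 1 (1 ℕ.+ r))
    ≡⟨ lemma (Jℤ c) (Jℤ (suc c)) (Jℤ r) (Jℤ (suc r)) _ _ (Jℤ-+ r c) (Jℤ-+ (suc r) c) ⟩
  Jℤ (3 ℕ.+ (r ℕ.+ c))
    ≡⟨ cong Jℤ {3 ℕ.+ (r ℕ.+ c)} {3 ℕ.+ c ℕ.+ r} (ℕ-Solver.solve (c ∷ r ∷ [])) ⟩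
  Jℤ (3 ℕ.+ c ℕ.+ r)
    ≡⟨ Jz≡Jℤ (3 ℕ.+ c ℕ.+ r) ⟨
  Jz (3 ℕ.+ c ℕ.+ r) ∎
  where
  lemma : ∀ c₀ c₁ r₀ r₁ y₀ y₁ →
    y₀ ≡ r₀ * c₁ + r₁ * c₀ - r₀ * c₀ → y₁ ≡ r₁ * c₁ + (r₁ + + 2 * r₀) * c₀ - r₁ * c₀ →
    let y₂ = y₁ + + 2 * y₀ in
    + 2 * (+ 1 * (y₁ + y₂) - + 1 * c₁ * r₀) - c₁ * r₁ * (+ 0 + + 1) - c₀ * r₁ * (+ 1 + + 1) ≡ y₂ + + 2 * y₁
  lemma c₀ c₁ r₀ r₁ _ _ refl refl = solve (c₀ ∷ c₁ ∷ r₀ ∷ r₁ ∷ [])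

H·adj-subdiag : ∀ t r →
  2x-y-z (adj (3 ℕ.+ t ℕ.+ r) (2 ℕ.+ t) (1 ℕ.+ t)) (adj (3 ℕ.+ t ℕ.+ r) (1 ℕ.+ t) (1 ℕ.+ t))
         (adj (3 ℕ.+ t ℕ.+ r) t (1 ℕ.+ t)) ≡ + 0
H·adj-subdiag t r = begin
  2x-y-z (adj (3 ℕ.+ t ℕ.+ r) (2 ℕ.+ t) (1 ℕ.+ t)) (adj (3 ℕ.+ t ℕ.+ r) (1 ℕ.+ t) (1 ℕ.+ t))
         (adj (3 ℕ.+ t ℕ.+ r) t (1 ℕ.+ t))
    ≡⟨ 2x-y-z-cong
         (adj-lower (3 ℕ.+ t ℕ.+ r) (2 ℕ.+ t) t 1 r (r ℕ.+ t)
                    (ℕ-Solver.solve (t ∷ r ∷ [])) (ℕ-Solver.solve (t ∷ [])) refl)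
         (adj-lower (3 ℕ.+ t ℕ.+ r) (1 ℕ.+ t) t 0 (1 ℕ.+ r) (1 ℕ.+ r ℕ.+ t)
                    (ℕ-Solver.solve (t ∷ r ∷ [])) (ℕ-Solver.solve (t ∷ [])) refl)
         (adj-upper (3 ℕ.+ t ℕ.+ r) (1 ℕ.+ t) t 0 (2 ℕ.+ r)
                    (ℕ-Solver.solve (t ∷ r ∷ [])) (ℕ-Solver.solve (t ∷ []))) ⟩
  2x-y-z (lowerEntry t 1 r (r ℕ.+ t)) (lowerEntry t 0 (1 ℕ.+ r) (1 ℕ.+ r ℕ.+ t)) (upperEntry t 0 (2 ℕ.+ r))
    ≡⟨ lemma (Jℤ t) (Jℤ r) (Jℤ (suc r)) (Jℤ (r ℕ.+ t)) (Jℤ (suc (r ℕ.+ t))) ⟩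
  + 0 ∎
  where
  lemma : ∀ t₀ r₀ r₁ w₀ w₁ → let r₂ = r₁ + + 2 * r₀; w₂ = w₁ + + 2 * w₀ in
    + 2 * (+ 1 * (w₀ + w₁) - (- + 1) * t₀ * r₀) - (+ 1 * (w₁ + w₂) - + 1 * t₀ * r₁)
      - t₀ * r₂ * (+ 0 + + 1) ≡ + 0
  lemma = solve-∀

H·adj-lower : ∀ t p r →
  2x-y-z (adj (4 ℕ.+ t ℕ.+ p ℕ.+ r) (3 ℕ.+ t ℕ.+ p) (1 ℕ.+ t))
         (adj (4 ℕ.+ t ℕ.+ p ℕ.+ r) (2 ℕ.+ t ℕ.+ p) (1 ℕ.+ t))
         (adj (4 ℕ.+ t ℕ.+ p ℕ.+ r) (1 ℕ.+ t ℕ.+ p) (1 ℕ.+ t)) ≡ + 0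
H·adj-lower t p r = begin
  2x-y-z (adj (4 ℕ.+ t ℕ.+ p ℕ.+ r) (3 ℕ.+ t ℕ.+ p) (1 ℕ.+ t))
         (adj (4 ℕ.+ t ℕ.+ p ℕ.+ r) (2 ℕ.+ t ℕ.+ p) (1 ℕ.+ t))
         (adj (4 ℕ.+ t ℕ.+ p ℕ.+ r) (1 ℕ.+ t ℕ.+ p) (1 ℕ.+ t))
    ≡⟨ 2x-y-z-cong
         (adj-lower (4 ℕ.+ t ℕ.+ p ℕ.+ r) (3 ℕ.+ t ℕ.+ p) t (2 ℕ.+ p) r (r ℕ.+ t)
                    (ℕ-Solver.solve (t ∷ p ∷ r ∷ [])) (ℕ-Solver.solve (t ∷ p ∷ [])) refl)
         (adj-lower (4 ℕ.+ t ℕ.+ p ℕ.+ r) (2 ℕ.+ t ℕ.+ p) t (1 ℕ.+ p) (1 ℕ.+ r) (1 ℕ.+ r ℕ.+ t)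
                    (ℕ-Solver.solve (t ∷ p ∷ r ∷ [])) (ℕ-Solver.solve (t ∷ p ∷ [])) refl)
         (adj-lower (4 ℕ.+ t ℕ.+ p ℕ.+ r) (1 ℕ.+ t ℕ.+ p) t p (2 ℕ.+ r) (2 ℕ.+ r ℕ.+ t)
                    (ℕ-Solver.solve (t ∷ p ∷ r ∷ [])) refl refl) ⟩
  2x-y-z (lowerEntry t (2 ℕ.+ p) r (r ℕ.+ t)) (lowerEntry t (1 ℕ.+ p) (1 ℕ.+ r) (1 ℕ.+ r ℕ.+ t))
         (lowerEntry t p (2 ℕ.+ r) (2 ℕ.+ r ℕ.+ t))
    ≡⟨ lemma (Jℤ t) (Jℤ p) (Jℤ (suc p)) (sgn p) (Jℤ r) (Jℤ (suc r)) (Jℤ (r ℕ.+ t)) (Jℤ (suc (r ℕ.+ t))) ⟩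
  + 0 ∎
  where
  lemma : ∀ t₀ p₀ p₁ s r₀ r₁ w₀ w₁ →
    let p₂ = p₁ + + 2 * p₀; p₃ = p₂ + + 2 * p₁; r₂ = r₁ + + 2 * r₀
        w₂ = w₁ + + 2 * w₀; w₃ = w₂ + + 2 * w₁ in
    + 2 * (p₃ * (w₀ + w₁) - (- (- s)) * t₀ * r₀) - (p₂ * (w₁ + w₂) - (- s) * t₀ * r₁)
      - (p₁ * (w₂ + w₃) - s * t₀ * r₂) ≡ + 0
  lemma = solve-∀

adj·H-last-diag : ∀ m → + 2 * adj (3 ℕ.+ m) (2 ℕ.+ m) (2 ℕ.+ m) - adj (3 ℕ.+ m) (2 ℕ.+ m) 1 ≡ Jz (3 ℕ.+ m)
adj·H-last-diag m = begin
  + 2 * adj (3 ℕ.+ m) (2 ℕ.+ m) (2 ℕ.+ m) - adj (3 ℕ.+ m) (2 ℕ.+ m) 1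
    ≡⟨ cong₂ (λ x y → + 2 * x - y)
         (adj-lower (3 ℕ.+ m) (2 ℕ.+ m) (1 ℕ.+ m) 0 0 (1 ℕ.+ m)
                    (ℕ-Solver.solve (m ∷ [])) (ℕ-Solver.solve (m ∷ [])) refl)
         (adj-lower (3 ℕ.+ m) (2 ℕ.+ m) 0 (1 ℕ.+ m) 0 0 (ℕ-Solver.solve (m ∷ [])) refl refl) ⟩
  + 2 * lowerEntry (1 ℕ.+ m) 0 0 (1 ℕ.+ m) - lowerEntry 0 (1 ℕ.+ m) 0 0
    ≡⟨ lemma (Jℤ m) (Jℤ (suc m)) (sgn m) ⟩
  Jℤ (3 ℕ.+ m)
    ≡⟨ Jz≡Jℤ (3 ℕ.+ m) ⟨
  Jz (3 ℕ.+ m) ∎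
  where
  lemma : ∀ m₀ m₁ s → let m₂ = m₁ + + 2 * m₀ in
    + 2 * (+ 1 * (m₁ + m₂) - + 1 * m₁ * + 0) - (m₂ * (+ 0 + + 1) - (- s) * + 0 * + 0) ≡ m₂ + + 2 * m₁
  lemma = solve-∀

adj·H-last-off : ∀ p q →
  + 2 * adj (3 ℕ.+ p ℕ.+ q) (1 ℕ.+ p) (2 ℕ.+ p ℕ.+ q) - adj (3 ℕ.+ p ℕ.+ q) (1 ℕ.+ p) 1 ≡ + 0
adj·H-last-off p q = begin
  + 2 * adj (3 ℕ.+ p ℕ.+ q) (1 ℕ.+ p) (2 ℕ.+ p ℕ.+ q) - adj (3 ℕ.+ p ℕ.+ q) (1 ℕ.+ p) 1
    ≡⟨ cong₂ (λ x y → + 2 * x - y)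
         (adj-upper (3 ℕ.+ p ℕ.+ q) (2 ℕ.+ p ℕ.+ q) (1 ℕ.+ p) q 1 (ℕ-Solver.solve (p ∷ q ∷ [])) refl)
         (adj-lower (3 ℕ.+ p ℕ.+ q) (1 ℕ.+ p) 0 p (1 ℕ.+ q) (1 ℕ.+ q)
                    (ℕ-Solver.solve (p ∷ q ∷ [])) refl (ℕ-Solver.solve (q ∷ []))) ⟩
  + 2 * upperEntry (1 ℕ.+ p) q 1 - lowerEntry 0 p (1 ℕ.+ q) (1 ℕ.+ q)
    ≡⟨ lemma (Jℤ (suc p)) (sgn p) (Jℤ q) (Jℤ (suc q)) ⟩
  + 0 ∎
  where
  lemma : ∀ p₁ s q₀ q₁ → let q₂ = q₁ + + 2 * q₀ in
    + 2 * (p₁ * + 1 * (q₀ + q₁)) - (p₁ * (q₁ + q₂) - s * + 0 * q₁) ≡ + 0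
  lemma = solve-∀

adj·H-upper : ∀ a q r →
  2x-y-z (adj (3 ℕ.+ a ℕ.+ q ℕ.+ r) a (1 ℕ.+ a ℕ.+ q)) (adj (3 ℕ.+ a ℕ.+ q ℕ.+ r) a (2 ℕ.+ a ℕ.+ q))
         (adj (3 ℕ.+ a ℕ.+ q ℕ.+ r) a (3 ℕ.+ a ℕ.+ q)) ≡ + 0
adj·H-upper a q r = begin
  2x-y-z (adj (3 ℕ.+ a ℕ.+ q ℕ.+ r) a (1 ℕ.+ a ℕ.+ q)) (adj (3 ℕ.+ a ℕ.+ q ℕ.+ r) a (2 ℕ.+ a ℕ.+ q))
         (adj (3 ℕ.+ a ℕ.+ q ℕ.+ r) a (3 ℕ.+ a ℕ.+ q))
    ≡⟨ 2x-y-z-cong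
         (adj-upper (3 ℕ.+ a ℕ.+ q ℕ.+ r) (1 ℕ.+ a ℕ.+ q) a q (2 ℕ.+ r)
                    (ℕ-Solver.solve (a ∷ q ∷ r ∷ [])) refl)
         (adj-upper (3 ℕ.+ a ℕ.+ q ℕ.+ r) (2 ℕ.+ a ℕ.+ q) a (1 ℕ.+ q) (1 ℕ.+ r)
                    (ℕ-Solver.solve (a ∷ q ∷ r ∷ [])) (ℕ-Solver.solve (a ∷ q ∷ [])))
         (adj-upper (3 ℕ.+ a ℕ.+ q ℕ.+ r) (3 ℕ.+ a ℕ.+ q) a (2 ℕ.+ q) r
                    (ℕ-Solver.solve (a ∷ q ∷ r ∷ [])) (ℕ-Solver.solve (a ∷ q ∷ []))) ⟩
  2x-y-z (upperEntry a q (2 ℕ.+ r)) (upperEntry a (1 ℕ.+ q) (1 ℕ.+ r)) (upperEntry a (2 ℕ.+ q) r)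
    ≡⟨ lemma (Jℤ a) (Jℤ q) (Jℤ (suc q)) (Jℤ r) (Jℤ (suc r)) ⟩
  + 0 ∎
  where
  lemma : ∀ a₀ q₀ q₁ r₀ r₁ → let q₂ = q₁ + + 2 * q₀; q₃ = q₂ + + 2 * q₁; r₂ = r₁ + + 2 * r₀ in
    + 2 * (a₀ * r₂ * (q₀ + q₁)) - a₀ * r₁ * (q₁ + q₂) - a₀ * r₀ * (q₂ + q₃) ≡ + 0
  lemma = solve-∀

adj·H-diag : ∀ t r →
  2x-y-z (adj (3 ℕ.+ t ℕ.+ r) (1 ℕ.+ t) (1 ℕ.+ t)) (adj (3 ℕ.+ t ℕ.+ r) (1 ℕ.+ t) (2 ℕ.+ t))
         (adj (3 ℕ.+ t ℕ.+ r) (1 ℕ.+ t) (3 ℕ.+ t)) ≡ Jz (3 ℕ.+ t ℕ.+ r)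
adj·H-diag t r = begin
  2x-y-z (adj (3 ℕ.+ t ℕ.+ r) (1 ℕ.+ t) (1 ℕ.+ t)) (adj (3 ℕ.+ t ℕ.+ r) (1 ℕ.+ t) (2 ℕ.+ t))
         (adj (3 ℕ.+ t ℕ.+ r) (1 ℕ.+ t) (3 ℕ.+ t))
    ≡⟨ 2x-y-z-cong
         (adj-lower (3 ℕ.+ t ℕ.+ r) (1 ℕ.+ t) t 0 (1 ℕ.+ r) (1 ℕ.+ r ℕ.+ t)
                    (ℕ-Solver.solve (t ∷ r ∷ [])) (ℕ-Solver.solve (t ∷ [])) refl)
         (adj-upper (3 ℕ.+ t ℕ.+ r) (2 ℕ.+ t) (1 ℕ.+ t) 0 (1 ℕ.+ r)
                    (ℕ-Solver.solve (t ∷ r ∷ [])) (ℕ-Solver.solve (t ∷ [])))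
         (adj-upper (3 ℕ.+ t ℕ.+ r) (3 ℕ.+ t) (1 ℕ.+ t) 1 r
                    (ℕ-Solver.solve (t ∷ r ∷ [])) (ℕ-Solver.solve (t ∷ []))) ⟩
  2x-y-z (lowerEntry t 0 (1 ℕ.+ r) (1 ℕ.+ r ℕ.+ t)) (upperEntry (1 ℕ.+ t) 0 (1 ℕ.+ r))
         (upperEntry (1 ℕ.+ t) 1 r)
    ≡⟨ lemma (Jℤ t) (Jℤ (suc t)) (Jℤ r) (Jℤ (suc r)) _ _ (Jℤ-+ r t) (Jℤ-+ (suc r) t) ⟩
  Jℤ (3 ℕ.+ (r ℕ.+ t))
    ≡⟨ cong Jℤ {3 ℕ.+ (r ℕ.+ t)} {3 ℕ.+ t ℕ.+ r} (ℕ-Solver.solve (t ∷ r ∷ [])) ⟩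
  Jℤ (3 ℕ.+ t ℕ.+ r)
    ≡⟨ Jz≡Jℤ (3 ℕ.+ t ℕ.+ r) ⟨
  Jz (3 ℕ.+ t ℕ.+ r) ∎
  where
  lemma : ∀ t₀ t₁ r₀ r₁ y₀ y₁ →
    y₀ ≡ r₀ * t₁ + r₁ * t₀ - r₀ * t₀ → y₁ ≡ r₁ * t₁ + (r₁ + + 2 * r₀) * t₀ - r₁ * t₀ →
    let y₂ = y₁ + + 2 * y₀ in
    + 2 * (+ 1 * (y₁ + y₂) - + 1 * t₀ * r₁) - t₁ * r₁ * (+ 0 + + 1) - t₁ * r₀ * (+ 1 + + 1) ≡ y₂ + + 2 * y₁
  lemma t₀ t₁ r₀ r₁ _ _ refl refl = solve (t₀ ∷ t₁ ∷ r₀ ∷ r₁ ∷ [])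

adj·H-subdiag : ∀ t r →
  2x-y-z (adj (3 ℕ.+ t ℕ.+ r) (2 ℕ.+ t) (1 ℕ.+ t)) (adj (3 ℕ.+ t ℕ.+ r) (2 ℕ.+ t) (2 ℕ.+ t))
         (adj (3 ℕ.+ t ℕ.+ r) (2 ℕ.+ t) (3 ℕ.+ t)) ≡ + 0
adj·H-subdiag t r = begin
  2x-y-z (adj (3 ℕ.+ t ℕ.+ r) (2 ℕ.+ t) (1 ℕ.+ t)) (adj (3 ℕ.+ t ℕ.+ r) (2 ℕ.+ t) (2 ℕ.+ t))
         (adj (3 ℕ.+ t ℕ.+ r) (2 ℕ.+ t) (3 ℕ.+ t))
    ≡⟨ 2x-y-z-cong
         (adj-lower (3 ℕ.+ t ℕ.+ r) (2 ℕ.+ t) t 1 r (r ℕ.+ t)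
                    (ℕ-Solver.solve (t ∷ r ∷ [])) (ℕ-Solver.solve (t ∷ [])) refl)
         (adj-lower (3 ℕ.+ t ℕ.+ r) (2 ℕ.+ t) (1 ℕ.+ t) 0 r (1 ℕ.+ (r ℕ.+ t))
                    (ℕ-Solver.solve (t ∷ r ∷ [])) (ℕ-Solver.solve (t ∷ [])) (ℕ-Solver.solve (t ∷ r ∷ [])))
         (adj-upper (3 ℕ.+ t ℕ.+ r) (3 ℕ.+ t) (2 ℕ.+ t) 0 r
                    (ℕ-Solver.solve (t ∷ r ∷ [])) (ℕ-Solver.solve (t ∷ []))) ⟩
  2x-y-z (lowerEntry t 1 r (r ℕ.+ t)) (lowerEntry (1 ℕ.+ t) 0 r (1 ℕ.+ (r ℕ.+ t))) (upperEntry (2 ℕ.+ t) 0 r)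
    ≡⟨ lemma (Jℤ t) (Jℤ (suc t)) (Jℤ r) (Jℤ (r ℕ.+ t)) (Jℤ (suc (r ℕ.+ t))) ⟩
  + 0 ∎
  where
  lemma : ∀ t₀ t₁ r₀ w₀ w₁ → let t₂ = t₁ + + 2 * t₀; w₂ = w₁ + + 2 * w₀ in
    + 2 * (+ 1 * (w₀ + w₁) - (- + 1) * t₀ * r₀) - (+ 1 * (w₁ + w₂) - + 1 * t₁ * r₀)
      - t₂ * r₀ * (+ 0 + + 1) ≡ + 0
  lemma = solve-∀

adj·H-lower : ∀ t p r →
  2x-y-z (adj (4 ℕ.+ t ℕ.+ p ℕ.+ r) (3 ℕ.+ t ℕ.+ p) (1 ℕ.+ t))
         (adj (4 ℕ.+ t ℕ.+ p ℕ.+ r) (3 ℕ.+ t ℕ.+ p) (2 ℕ.+ t))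
         (adj (4 ℕ.+ t ℕ.+ p ℕ.+ r) (3 ℕ.+ t ℕ.+ p) (3 ℕ.+ t)) ≡ + 0
adj·H-lower t p r = begin
  2x-y-z (adj (4 ℕ.+ t ℕ.+ p ℕ.+ r) (3 ℕ.+ t ℕ.+ p) (1 ℕ.+ t))
         (adj (4 ℕ.+ t ℕ.+ p ℕ.+ r) (3 ℕ.+ t ℕ.+ p) (2 ℕ.+ t))
         (adj (4 ℕ.+ t ℕ.+ p ℕ.+ r) (3 ℕ.+ t ℕ.+ p) (3 ℕ.+ t))
    ≡⟨ 2x-y-z-cong
         (adj-lower (4 ℕ.+ t ℕ.+ p ℕ.+ r) (3 ℕ.+ t ℕ.+ p) t (2 ℕ.+ p) r (r ℕ.+ t)
                    (ℕ-Solver.solve (t ∷ p ∷ r ∷ [])) (ℕ-Solver.solve (t ∷ p ∷ [])) refl)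
         (adj-lower (4 ℕ.+ t ℕ.+ p ℕ.+ r) (3 ℕ.+ t ℕ.+ p) (1 ℕ.+ t) (1 ℕ.+ p) r (1 ℕ.+ (r ℕ.+ t))
                    (ℕ-Solver.solve (t ∷ p ∷ r ∷ [])) (ℕ-Solver.solve (t ∷ p ∷ [])) (ℕ-Solver.solve (t ∷ r ∷ [])))
         (adj-lower (4 ℕ.+ t ℕ.+ p ℕ.+ r) (3 ℕ.+ t ℕ.+ p) (2 ℕ.+ t) p r (2 ℕ.+ (r ℕ.+ t))
                    (ℕ-Solver.solve (t ∷ p ∷ r ∷ [])) refl (ℕ-Solver.solve (t ∷ r ∷ []))) ⟩
  2x-y-z (lowerEntry t (2 ℕ.+ p) r (r ℕ.+ t)) (lowerEntry (1 ℕ.+ t) (1 ℕ.+ p) r (1 ℕ.+ (r ℕ.+ t)))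
         (lowerEntry (2 ℕ.+ t) p r (2 ℕ.+ (r ℕ.+ t)))
    ≡⟨ lemma (Jℤ t) (Jℤ (suc t)) (Jℤ p) (Jℤ (suc p)) (sgn p) (Jℤ r) (Jℤ (r ℕ.+ t)) (Jℤ (suc (r ℕ.+ t))) ⟩
  + 0 ∎
  where
  lemma : ∀ t₀ t₁ p₀ p₁ s r₀ w₀ w₁ →
    let t₂ = t₁ + + 2 * t₀; p₂ = p₁ + + 2 * p₀; p₃ = p₂ + + 2 * p₁
        w₂ = w₁ + + 2 * w₀; w₃ = w₂ + + 2 * w₁ in
    + 2 * (p₃ * (w₀ + w₁) - (- (- s)) * t₀ * r₀) - (p₂ * (w₁ + w₂) - (- s) * t₁ * r₀)
      - (p₁ * (w₂ + w₃) - s * t₂ * r₀) ≡ + 0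
  lemma = solve-∀

Jδ : ℕ → ℕ → ℕ → ℤ
Jδ N a b = if a ≡ᵇ b then Jz N else + 0

Jδ-diag : ∀ N a → Jδ N a a ≡ Jz N
Jδ-diag N a = cong (λ x → if x then Jz N else + 0) (≡ᵇ-true {a} refl)

Jδ-off : ∀ N {a b} → a ≢ b → Jδ N a b ≡ + 0
Jδ-off N a≢b = cong (λ x → if x then Jz N else + 0) (≡ᵇ-false a≢b)

-- The hypothesis X 0 ≡ 0 of rowSum holds by refl: row 0 of adj vanishes by computation.
H·adj≡Jδ : ∀ n a b → 2 ≤ n → 1 ≤ a → a ≤ n → 1 ≤ b → b ≤ n →
  sumℕ n (λ k → hℤ n a (suc k) * adj (suc n) (suc k) b) ≡ Jδ (suc n) a b
H·adj≡Jδ (suc zero) 1 1 (s≤s ()) _ _ _ _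
H·adj≡Jδ (suc (suc m)) 1 1 _ _ _ _ _ =
  trans (rowSum-first (suc m) (λ i → adj (3 ℕ.+ m) i 1)) (H·adj-first-diag m)
H·adj≡Jδ n 1 (suc (suc q)) _ _ _ _ b≤n with ℕ.m≤n⇒∃[o]m+o≡n b≤n
... | r , refl =
  trans (rowSum-first (1 ℕ.+ q ℕ.+ r) (λ i → adj (3 ℕ.+ q ℕ.+ r) i (2 ℕ.+ q))) (H·adj-first-off q r)
H·adj≡Jδ n (suc (suc c)) b _ _ a≤n _ b≤n with ℕ.<-cmp (suc (suc c)) b
... | tri< a<b _ _ with ℕ.m≤n⇒∃[o]m+o≡n a<b | ℕ.m≤n⇒∃[o]m+o≡n b≤n
...   | q , refl | r , refl = begin
  _ ≡⟨ rowSum (3 ℕ.+ c ℕ.+ q ℕ.+ r) c (λ i → adj (4 ℕ.+ c ℕ.+ q ℕ.+ r) i (3 ℕ.+ c ℕ.+ q)) a≤n refl ⟩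
  _ ≡⟨ H·adj-upper c q r ⟩
  _ ≡⟨ Jδ-off (4 ℕ.+ c ℕ.+ q ℕ.+ r) (ℕ.<⇒≢ a<b) ⟨
  _ ∎
H·adj≡Jδ n (suc (suc c)) b _ _ a≤n _ b≤n | tri≈ _ refl _ with ℕ.m≤n⇒∃[o]m+o≡n a≤n
...   | r , refl = begin
  _ ≡⟨ rowSum (2 ℕ.+ c ℕ.+ r) c (λ i → adj (3 ℕ.+ c ℕ.+ r) i (2 ℕ.+ c)) a≤n refl ⟩
  _ ≡⟨ H·adj-diag c r ⟩
  _ ≡⟨ Jδ-diag (3 ℕ.+ c ℕ.+ r) (2 ℕ.+ c) ⟨
  _ ∎
H·adj≡Jδ n (suc (suc c)) (suc t) _ _ a≤n _ _ | tri> _ _ b<a with ℕ.m≤n⇒m<n∨m≡n b<a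
...   | inj₂ refl with ℕ.m≤n⇒∃[o]m+o≡n a≤n
...     | r , refl = begin
  _ ≡⟨ rowSum (2 ℕ.+ t ℕ.+ r) t (λ i → adj (3 ℕ.+ t ℕ.+ r) i (1 ℕ.+ t)) a≤n refl ⟩
  _ ≡⟨ H·adj-subdiag t r ⟩
  _ ≡⟨ Jδ-off (3 ℕ.+ t ℕ.+ r) (ℕ.>⇒≢ b<a) ⟨
  _ ∎
H·adj≡Jδ n (suc (suc c)) (suc t) _ _ a≤n _ _ | tri> _ _ b<a | inj₁ b+1<a
  with ℕ.m≤n⇒∃[o]m+o≡n b+1<a
...   | p , refl with ℕ.m≤n⇒∃[o]m+o≡n a≤n
...     | r , refl = begin
  _ ≡⟨ rowSum (3 ℕ.+ t ℕ.+ p ℕ.+ r) (1 ℕ.+ t ℕ.+ p) (λ i → adj (4 ℕ.+ t ℕ.+ p ℕ.+ r) i (1 ℕ.+ t)) a≤n refl ⟩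
  _ ≡⟨ H·adj-lower t p r ⟩
  _ ≡⟨ Jδ-off (4 ℕ.+ t ℕ.+ p ℕ.+ r) (ℕ.>⇒≢ b<a) ⟨
  _ ∎

adj·H≡Jδ : ∀ n a b → 2 ≤ n → 1 ≤ a → a ≤ n → 1 ≤ b → b ≤ n →
  sumℕ n (λ k → adj (suc n) a (suc k) * hℤ n (suc k) b) ≡ Jδ (suc n) a b
adj·H≡Jδ n a b 2≤n 1≤a a≤n 1≤b b≤n with ℕ.m≤n⇒m<n∨m≡n b≤n
adj·H≡Jδ n a b 2≤n 1≤a a≤n 1≤b b≤n | inj₂ refl with ℕ.m≤n⇒m<n∨m≡n a≤n | 2≤n
... | inj₂ refl | s≤s (s≤s {n = m} _) = begin
  _ ≡⟨ colSum-last (1 ℕ.+ m) (adj (3 ℕ.+ m) (2 ℕ.+ m)) ⟩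
  _ ≡⟨ adj·H-last-diag m ⟩
  _ ≡⟨ Jδ-diag (3 ℕ.+ m) (2 ℕ.+ m) ⟨
  _ ∎
... | inj₁ a<n | _ with 1≤a | ℕ.m≤n⇒∃[o]m+o≡n a<n
...   | s≤s {n = p} _ | q , refl = begin
  _ ≡⟨ colSum-last (1 ℕ.+ p ℕ.+ q) (adj (3 ℕ.+ p ℕ.+ q) (1 ℕ.+ p)) ⟩
  _ ≡⟨ adj·H-last-off p q ⟩
  _ ≡⟨ Jδ-off (3 ℕ.+ p ℕ.+ q) (ℕ.<⇒≢ a<n) ⟨
  _ ∎
adj·H≡Jδ n a b 2≤n 1≤a a≤n 1≤b b≤n | inj₁ b<n with ℕ.<-cmp a b
... | tri< a<b _ _ with ℕ.m≤n⇒∃[o]m+o≡n a<b | ℕ.m≤n⇒∃[o]m+o≡n b<n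
...   | q , refl | r , refl = begin
  _ ≡⟨ colSum (2 ℕ.+ a ℕ.+ q ℕ.+ r) (1 ℕ.+ a ℕ.+ q) (adj (3 ℕ.+ a ℕ.+ q ℕ.+ r) a) 1≤b b<n
              (adj-last-column (2 ℕ.+ a ℕ.+ q ℕ.+ r) a a≤n) ⟩
  _ ≡⟨ adj·H-upper a q r ⟩
  _ ≡⟨ Jδ-off (3 ℕ.+ a ℕ.+ q ℕ.+ r) (ℕ.<⇒≢ a<b) ⟨
  _ ∎
adj·H≡Jδ n a b 2≤n 1≤a a≤n 1≤b b≤n | inj₁ b<n | tri≈ _ refl _ with 1≤b | ℕ.m≤n⇒∃[o]m+o≡n b<n
...   | s≤s {n = t} _ | r , refl = begin
  _ ≡⟨ colSum (2 ℕ.+ t ℕ.+ r) (1 ℕ.+ t) (adj (3 ℕ.+ t ℕ.+ r) (1 ℕ.+ t)) 1≤b b<n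
              (adj-last-column (2 ℕ.+ t ℕ.+ r) (1 ℕ.+ t) a≤n) ⟩
  _ ≡⟨ adj·H-diag t r ⟩
  _ ≡⟨ Jδ-diag (3 ℕ.+ t ℕ.+ r) (1 ℕ.+ t) ⟨
  _ ∎
adj·H≡Jδ n a b 2≤n 1≤a a≤n 1≤b b≤n | inj₁ b<n | tri> _ _ b<a with 1≤b | ℕ.m≤n⇒m<n∨m≡n b<a
...   | s≤s {n = t} _ | inj₂ refl with ℕ.m≤n⇒∃[o]m+o≡n a≤n
...     | r , refl = begin
  _ ≡⟨ colSum (2 ℕ.+ t ℕ.+ r) (1 ℕ.+ t) (adj (3 ℕ.+ t ℕ.+ r) (2 ℕ.+ t)) 1≤b b<n
              (adj-last-column (2 ℕ.+ t ℕ.+ r) (2 ℕ.+ t) a≤n) ⟩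
  _ ≡⟨ adj·H-subdiag t r ⟩
  _ ≡⟨ Jδ-off (3 ℕ.+ t ℕ.+ r) (ℕ.>⇒≢ b<a) ⟨
  _ ∎
adj·H≡Jδ n a b 2≤n 1≤a a≤n 1≤b b≤n | inj₁ b<n | tri> _ _ b<a | s≤s {n = t} _ | inj₁ b+1<a
  with ℕ.m≤n⇒∃[o]m+o≡n b+1<a
...   | p , refl with ℕ.m≤n⇒∃[o]m+o≡n a≤n
...     | r , refl = begin
  _ ≡⟨ colSum (3 ℕ.+ t ℕ.+ p ℕ.+ r) (1 ℕ.+ t) (adj (4 ℕ.+ t ℕ.+ p ℕ.+ r) (3 ℕ.+ t ℕ.+ p)) 1≤b b<n
              (adj-last-column (3 ℕ.+ t ℕ.+ p ℕ.+ r) (3 ℕ.+ t ℕ.+ p) a≤n) ⟩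
  _ ≡⟨ adj·H-lower t p r ⟩
  _ ≡⟨ Jδ-off (4 ℕ.+ t ℕ.+ p ℕ.+ r) (ℕ.>⇒≢ b<a) ⟨
  _ ∎

fromℚᵘ-+ : ∀ p q → ℚ.fromℚᵘ p ℚ.+ ℚ.fromℚᵘ q ≡ ℚ.fromℚᵘ (p ℚᵘ.+ q)
fromℚᵘ-+ p q = ℚ.toℚᵘ-injective (ℚᵘ.≃-trans (ℚ.toℚᵘ-homo-+ (ℚ.fromℚᵘ p) (ℚ.fromℚᵘ q))
  (ℚᵘ.≃-trans (ℚᵘ.+-cong (ℚ.toℚᵘ-fromℚᵘ p) (ℚ.toℚᵘ-fromℚᵘ q))
              (ℚᵘ.≃-sym (ℚ.toℚᵘ-fromℚᵘ (p ℚᵘ.+ q)))))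

fromℚᵘ-* : ∀ p q → ℚ.fromℚᵘ p ℚ.* ℚ.fromℚᵘ q ≡ ℚ.fromℚᵘ (p ℚᵘ.* q)
fromℚᵘ-* p q = ℚ.toℚᵘ-injective (ℚᵘ.≃-trans (ℚ.toℚᵘ-homo-* (ℚ.fromℚᵘ p) (ℚ.fromℚᵘ q))
  (ℚᵘ.≃-trans (ℚᵘ.*-cong (ℚ.toℚᵘ-fromℚᵘ p) (ℚ.toℚᵘ-fromℚᵘ q))
              (ℚᵘ.≃-sym (ℚ.toℚᵘ-fromℚᵘ (p ℚᵘ.* q)))))

/-+ : ∀ x y d .{{_ : NonZero d}} → x ℚ./ d ℚ.+ y ℚ./ d ≡ (x + y) ℚ./ d
/-+ x y (suc k) = trans (fromℚᵘ-+ (ℚᵘ.mkℚᵘ x k) (ℚᵘ.mkℚᵘ y k))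
  (ℚ.fromℚᵘ-cong {ℚᵘ.mkℚᵘ x k ℚᵘ.+ ℚᵘ.mkℚᵘ y k} {ℚᵘ.mkℚᵘ (x + y) k} (ℚᵘ.*≡* (begin
  (x * + suc k + y * + suc k) * + suc k        ≡⟨ lemma x y (+ suc k) ⟩
  (x + y) * (+ suc k * + suc k)               ≡⟨ cong ((x + y) *_) (ℤ.pos-* (suc k) (suc k)) ⟨
  (x + y) * + (suc k ℕ.* suc k)               ∎)))
  where
  lemma : ∀ x y d → (x * d + y * d) * d ≡ (x + y) * (d * d)
  lemma = solve-∀

/1-* : ∀ x y d .{{_ : NonZero d}} → (x ℚ./ 1) ℚ.* (y ℚ./ d) ≡ (x * y) ℚ./ d
/1-* x y (suc k) = trans (fromℚᵘ-* (ℚᵘ.mkℚᵘ x 0) (ℚᵘ.mkℚᵘ y k))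
  (ℚ.fromℚᵘ-cong {ℚᵘ.mkℚᵘ x 0 ℚᵘ.* ℚᵘ.mkℚᵘ y k} {ℚᵘ.mkℚᵘ (x * y) k}
                  (ℚᵘ.*≡* (cong (λ m → x * y * + m) (sym (ℕ.*-identityˡ (suc k))))))

*-/1 : ∀ x y d .{{_ : NonZero d}} → (x ℚ./ d) ℚ.* (y ℚ./ 1) ≡ (x * y) ℚ./ d
*-/1 x y (suc k) = trans (fromℚᵘ-* (ℚᵘ.mkℚᵘ x k) (ℚᵘ.mkℚᵘ y 0))
  (ℚ.fromℚᵘ-cong {ℚᵘ.mkℚᵘ x k ℚᵘ.* ℚᵘ.mkℚᵘ y 0} {ℚᵘ.mkℚᵘ (x * y) k}
                  (ℚᵘ.*≡* (cong (λ m → x * y * + m) (sym (ℕ.*-identityʳ (suc k))))))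

0/d : ∀ d .{{_ : NonZero d}} → + 0 ℚ./ d ≡ ℚ.0ℚ
0/d (suc k) = ℚ.fromℚᵘ-cong {ℚᵘ.mkℚᵘ (+ 0) k} {ℚᵘ.0ℚᵘ} (ℚᵘ.*≡* refl)

d/d : ∀ d .{{_ : NonZero d}} → + d ℚ./ d ≡ ℚ.1ℚ
d/d (suc k) = ℚ.fromℚᵘ-cong {ℚᵘ.mkℚᵘ (+ suc k) k} {ℚᵘ.1ℚᵘ} (ℚᵘ.*≡* (ℤ.*-comm (+ suc k) (+ 1)))

sumFin-cong : ∀ m {f g : Fin m → ℚ.ℚ} → (∀ k → f k ≡ g k) → sumFin m f ≡ sumFin m g
sumFin-cong zero f≗g = refl
sumFin-cong (suc m) f≗g = cong₂ ℚ._+_ (f≗g Fin.zero) (sumFin-cong m (λ k → f≗g (Fin.suc k)))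

sumFin-/ : ∀ m d .{{_ : NonZero d}} (g : ℕ → ℤ) → sumFin m (λ k → g (toℕ k) ℚ./ d) ≡ sumℕ m g ℚ./ d
sumFin-/ zero d g = sym (0/d d)
sumFin-/ (suc m) d g =
  trans (cong (λ z → g 0 ℚ./ d ℚ.+ z) (sumFin-/ m d (λ k → g (suc k))))
        (/-+ (g 0) (sumℕ m (λ k → g (suc k))) d)

H≡hℤ/1 : ∀ n (i k : Fin n) → 2 ≤ n → H (suc n) i k ≡ hℤ n (suc (toℕ i)) (suc (toℕ k)) ℚ./ 1
H≡hℤ/1 n i k 2≤n = Hentry≡hℤ n _ _ 2≤n (s≤s z≤n) (Fin.toℕ<n i) (s≤s z≤n) (Fin.toℕ<n k)

Hinv≡adj/J : ∀ n (i j : Fin n) → 2 ≤ n →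
  Hinv (suc n) i j ≡ divJ (adj (suc n) (suc (toℕ i)) (suc (toℕ j))) (suc n)
Hinv≡adj/J n i j 2≤n = HinvEntry≡adj n (suc (toℕ i)) (suc (toℕ j)) (ℕ.≤-trans (ℕ.n≤1+n 1) 2≤n) (Fin.toℕ<n j)

mul≡sumℕ/ : ∀ n d .{{_ : NonZero d}} (A B : Mat (suc n)) (f : ℕ → ℤ) i j →
  (∀ k → A i k ℚ.* B k j ≡ f (suc (toℕ k)) ℚ./ d) → mul (suc n) A B i j ≡ sumℕ n (λ k → f (suc k)) ℚ./ d
mul≡sumℕ/ n d A B f i j AB≡f/d = trans (sumFin-cong n AB≡f/d) (sumFin-/ n d (λ k → f (suc k)))

Jδ/J≡I : ∀ n (i j : Fin n) → divJ (Jδ (suc n) (suc (toℕ i)) (suc (toℕ j))) (suc n) ≡ I (suc n) i j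
Jδ/J≡I n i j with toℕ i ≡ᵇ toℕ j
... | true = d/d (J (suc n)) {{J-nonZero n}}
... | false = 0/d (J (suc n)) {{J-nonZero n}}

H·Hinv≡I : ∀ n → 2 ≤ n → ∀ i j → mul (suc n) (H (suc n)) (Hinv (suc n)) i j ≡ I (suc n) i j
H·Hinv≡I n 2≤n i j = begin
  mul (suc n) (H (suc n)) (Hinv (suc n)) i j
    ≡⟨ mul≡sumℕ/ n (J (suc n)) {{J-nonZero n}} (H (suc n)) (Hinv (suc n)) (λ k → hℤ n a k * adj (suc n) k b) i j
         (λ k → trans (cong₂ ℚ._*_ (H≡hℤ/1 n i k 2≤n) (Hinv≡adj/J n k j 2≤n))
                      (/1-* (hℤ n a (suc (toℕ k))) (adj (suc n) (suc (toℕ k)) b) (J (suc n)) {{J-nonZero n}})) ⟩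
  divJ (sumℕ n (λ k → hℤ n a (suc k) * adj (suc n) (suc k) b)) (suc n)
    ≡⟨ cong (λ z → divJ z (suc n)) (H·adj≡Jδ n a b 2≤n (s≤s z≤n) (Fin.toℕ<n i) (s≤s z≤n) (Fin.toℕ<n j)) ⟩
  divJ (Jδ (suc n) a b) (suc n)
    ≡⟨ Jδ/J≡I n i j ⟩
  I (suc n) i j ∎
  where
  a = suc (toℕ i)
  b = suc (toℕ j)

Hinv·H≡I : ∀ n → 2 ≤ n → ∀ i j → mul (suc n) (Hinv (suc n)) (H (suc n)) i j ≡ I (suc n) i j
Hinv·H≡I n 2≤n i j = begin
  mul (suc n) (Hinv (suc n)) (H (suc n)) i j
    ≡⟨ mul≡sumℕ/ n (J (suc n)) {{J-nonZero n}} (Hinv (suc n)) (H (suc n)) (λ k → adj (suc n) a k * hℤ n k b) i j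
         (λ k → trans (cong₂ ℚ._*_ (Hinv≡adj/J n i k 2≤n) (H≡hℤ/1 n k j 2≤n))
                      (*-/1 (adj (suc n) a (suc (toℕ k))) (hℤ n (suc (toℕ k)) b) (J (suc n)) {{J-nonZero n}})) ⟩
  divJ (sumℕ n (λ k → adj (suc n) a (suc k) * hℤ n (suc k) b)) (suc n)
    ≡⟨ cong (λ z → divJ z (suc n)) (adj·H≡Jδ n a b 2≤n (s≤s z≤n) (Fin.toℕ<n i) (s≤s z≤n) (Fin.toℕ<n j)) ⟩
  divJ (Jδ (suc n) a b) (suc n)
    ≡⟨ Jδ/J≡I n i j ⟩
  I (suc n) i j ∎
  where
  a = suc (toℕ i)
  b = suc (toℕ j)

mainTheorem1 : (N : ℕ) → 3 ≤ N → IsInverse N (H N) (Hinv N)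
mainTheorem1 (suc n) (s≤s 2≤n) = H·Hinv≡I n 2≤n , Hinv·H≡I n 2≤n
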